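{- Let $G$ be a graph, let $L,R$ be a partition of $V(G)$ and let $H$ be a $(3,L)$-admissible packing rooted at $u \in L$ which is covering and chordless. Let $y \in \mathrm{Target}^3_L(u) \setminus \mathrm{Target}^1_L(u)$. Then there exists in $G$ either a path $uwy$ or a path $uwxy$ with $w,x \in R$, where $w \in V(H)$.
   Context: All graphs are finite and simple; length of a path = number of edges. For $L\subseteq V(G)$, a path avoids $L$ if none of its inner vertices lies in $L$ (endpoints may). A path from $v$ to $x$ is $(r,L)$-admissible if it has length at most $r$ and avoids $L$. $\mathrm{Target}^r_L(v)$ is the set of $x \in L$, $x\ne v$, reachable from $v$ by an $(r,L)$-admissible path. An $(r,L)$-admissible packing rooted at $v$ is a collection of $(r,L)$-admissible paths $vP_1x_1,\dots,vP_kx_k$ such that the sequences $P_ix_i$ are pairwise vertex-disjoint and each $x_i \in \mathrm{Target}^r_L(v)$; $V(H)$ is the set of vertices on its paths. A packing $H$ rooted at $v\in L$ is chordless if for every path $vwP\in H$ ($P$ possibly empty) there is no edge between $v$ and a vertex of $P$. It is covering if for every $x \in \mathrm{Target}^3_L(v)$, either $x \in N(v)$ and the path $vx$ is in $H$, or there exists a $(3,L)$-admissible path from $x$ to $v$ which contains a vertex of $V(H)\setminus\{v\}$. -}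

module Defs where

open import Data.Nat using (ℕ; suc; _≤_)
open import Data.Fin using (Fin)
open import Data.List using (List; []; _∷_; _++_; [_]; length)
open import Data.List.Relation.Unary.All using (All)
open import Data.List.Relation.Unary.Any using (Any)
open import Data.List.Relation.Unary.AllPairs using (AllPairs)
open import Data.List.Relation.Unary.Unique.Propositional using (Unique)
open import Data.List.Relation.Unary.Linked using (Linked)
open import Data.List.Relation.Binary.Disjoint.Propositional using (Disjoint)
open import Data.List.Membership.Propositional using (_∈_)
open import Data.Product using (_×_; _,_; Σ; ∃; ∃-syntax)
open import Data.Sum using (_⊎_)
open import Data.Empty using (⊥)
open import Relation.Nullary using (¬_)
open import Relation.Binary.PropositionalEquality using (_≡_; _≢_)

record Graph : Set₁ where
  field
    n      : ℕ
    Adj    : Fin n → Fin n → Set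
    sym    : ∀ {u v} → Adj u v → Adj v u
    irrefl : ∀ {v} → ¬ Adj v v

module _ (G : Graph) where
  open Graph G

  V : Set
  V = Fin n

  IsPartition : (V → Set) → (V → Set) → Set
  IsPartition L R = (∀ v → L v ⊎ R v) × (∀ v → L v → R v → ⊥)

  -- v P x is a path: the vertex sequence v ∷ P ++ [ x ] has pairwise
  -- distinct vertices and consecutive vertices adjacent.
  -- Its length (number of edges) is length P + 1.
  IsPath : V → List V → V → Set
  IsPath v P x = Unique (v ∷ P ++ [ x ]) × Linked Adj (v ∷ P ++ [ x ])

  Avoids : (V → Set) → List V → Set
  Avoids L P = All (λ z → ¬ L z) P

  Admissible : ℕ → (V → Set) → V → List V → V → Set
  Admissible r L v P x = IsPath v P x × suc (length P) ≤ r × Avoids L P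

  Target : ℕ → (V → Set) → V → V → Set
  Target r L v x = L x × x ≢ v × ∃[ P ] Admissible r L v P x

  -- A packing is given as a list of pairs (P_i , x_i), standing for the
  -- paths v P_i x_i.
  Packing : Set
  Packing = List (List V × V)

  seq : List V × V → List V
  seq (P , x) = P ++ [ x ]

  IsAdmissiblePacking : ℕ → (V → Set) → V → Packing → Set
  IsAdmissiblePacking r L v H =
    All (λ e → Admissible r L v (Data.Product.proj₁ e) (Data.Product.proj₂ e)
             × Target r L v (Data.Product.proj₂ e)) H
    × AllPairs (λ e f → Disjoint (seq e) (seq f)) H

  InV : V → Packing → V → Set
  InV v H z = z ≡ v ⊎ Any (λ e → z ∈ seq e) H

  Chordless : V → Packing → Set
  Chordless v H =
    All (λ e → ∀ w P → seq e ≡ w ∷ P → ∀ z → z ∈ P → ¬ Adj v z) H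

  Covering : (V → Set) → V → Packing → Set
  Covering L v H =
    ∀ x → Target 3 L v x →
      (Adj v x × (([] , x) ∈ H))
      ⊎ (∃[ Q ] (Admissible 3 L x Q v
                 × ∃[ z ] (z ∈ (x ∷ Q ++ [ v ]) × InV v H z × z ≢ v)))

module Submission where

-- Covering yields a (3,L)-admissible path y Q u through some z ∈ V(H) ∖ {u}; its inner
-- vertices lie in R.  If z = y, then y ∈ L forces y to be the endpoint of a packing path
-- u P y, and P ≠ [] since y is not adjacent to u: that packing path is the answer.  If z is
-- the neighbour of u on Q, reversing the covering path gives the answer.  Otherwise
-- Q = z b with z ∈ R adjacent to y; z lies on a packing path u P x but is not its endpoint
-- x ∈ L, so the segment of that path from u to z, extended by y, is the answer.

open import Defs
open import Data.List using (List; []; _∷_; _++_; [_]; _∷ʳ_; reverse; reverseAcc)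
open import Data.List.Properties using (++-assoc; unfold-reverse; reverse-++)
open import Data.List.Membership.Propositional using (_∈_; _∉_; find; lose)
open import Data.List.Membership.Propositional.Properties using (∈-++⁻)
open import Data.List.Relation.Unary.All as All using (All; []; _∷_)
open import Data.List.Relation.Unary.All.Properties using (All¬⇒¬Any; ++⁻ˡ)
open import Data.List.Relation.Unary.AllPairs using (AllPairs; []; _∷_)
open import Data.List.Relation.Unary.Any using (here; there)
open import Data.List.Relation.Unary.Linked using (Linked; []; [-]; _∷_)
open import Data.List.Relation.Unary.Unique.Propositional using (Unique)
open import Data.List.Relation.Unary.Unique.Propositional.Properties as Unique using ()
open import Data.List.Relation.Binary.Permutation.Setoid as ↭ using ()
open import Data.List.Relation.Binary.Permutation.Setoid.Properties as ↭ₚ using ()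
open import Data.Nat using (s≤s; z≤n)
open import Data.Product using (_×_; ∃-syntax; _,_; proj₁; proj₂)
open import Data.Sum using (_⊎_; inj₁; inj₂)
open import Data.Empty using (⊥-elim)
open import Level using (Level)
open import Relation.Binary using (Rel; Symmetric)
open import Relation.Nullary using (¬_)
open import Relation.Binary.PropositionalEquality using (_≡_; refl; sym; _≢_; ≢-sym; subst; cong; setoid; module ≡-Reasoning)

module _ {a ℓ : Level} {A : Set a} {R : Rel A ℓ} where

  Linked-++⁻ˡ : ∀ xs {ys} → Linked R (xs ++ ys) → Linked R xs
  Linked-++⁻ˡ []           _        = []
  Linked-++⁻ˡ (x ∷ [])     _        = [-]
  Linked-++⁻ˡ (x ∷ y ∷ xs) (r ∷ rs) = r ∷ Linked-++⁻ˡ (y ∷ xs) rs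

  AllPairs-++⁻ˡ : ∀ xs {ys} → AllPairs R (xs ++ ys) → AllPairs R xs
  AllPairs-++⁻ˡ []       _          = []
  AllPairs-++⁻ˡ (x ∷ xs) (px ∷ pxs) = ++⁻ˡ xs px ∷ AllPairs-++⁻ˡ xs pxs

  Linked-∷ʳ : ∀ {x} xs {y z} → Linked R (x ∷ xs ∷ʳ y) → R y z → Linked R (x ∷ xs ∷ʳ y ∷ʳ z)
  Linked-∷ʳ []       (r ∷ [-]) r′ = r ∷ r′ ∷ [-]
  Linked-∷ʳ (w ∷ xs) (r ∷ rs)  r′ = r ∷ Linked-∷ʳ xs rs r′

  module _ (R-sym : Symmetric R) where

    Linked-reverseAcc : ∀ {x} xs {ys} → Linked R (x ∷ xs) → Linked R (x ∷ ys) →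
                        Linked R (reverseAcc (x ∷ ys) xs)
    Linked-reverseAcc []       _        rys = rys
    Linked-reverseAcc (y ∷ xs) (r ∷ rs) rys = Linked-reverseAcc xs rs (R-sym r ∷ rys)

    Linked-reverse : ∀ {xs} → Linked R xs → Linked R (reverse xs)
    Linked-reverse {[]}     _   = []
    Linked-reverse {x ∷ xs} rxs = Linked-reverseAcc xs rxs [-]

module Paths (G : Graph) where
  open Graph G renaming (sym to Adj-sym)

  IsSimple : List (V G) → Set
  IsSimple xs = Unique xs × Linked Adj xs

  Unique-reverse : ∀ {xs : List (V G)} → Unique xs → Unique (reverse xs)
  Unique-reverse {xs} =
    ↭ₚ.Unique-resp-↭ (setoid (V G)) (↭.↭-sym (setoid (V G)) (↭ₚ.↭-reverse (setoid (V G)) xs))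

  reverse-path : ∀ (v : V G) P x → reverse (v ∷ P ++ [ x ]) ≡ x ∷ reverse P ++ [ v ]
  reverse-path v P x = begin
    reverse (v ∷ P ++ [ x ])   ≡⟨ unfold-reverse v (P ++ [ x ]) ⟩
    reverse (P ++ [ x ]) ∷ʳ v  ≡⟨ cong (_∷ʳ v) (reverse-++ P [ x ]) ⟩
    x ∷ reverse P ++ [ v ]     ∎
    where open ≡-Reasoning

  IsPath-reverse : ∀ {v} P {x} → IsPath G v P x → IsPath G x (reverse P) v
  IsPath-reverse {v} P {x} (uniq , linked) =
    subst IsSimple (reverse-path v P x)
          (Unique-reverse uniq , Linked-reverse Adj-sym linked)

  prefix-path : ∀ (v : V G) P a Q x → v ∷ (P ++ a ∷ Q) ++ [ x ] ≡ (v ∷ P ++ [ a ]) ++ Q ++ [ x ]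
  prefix-path v P a Q x = cong (v ∷_) (begin
    (P ++ a ∷ Q) ++ [ x ]      ≡⟨ ++-assoc P (a ∷ Q) [ x ] ⟩
    P ++ a ∷ Q ++ [ x ]        ≡⟨ sym (++-assoc P [ a ] (Q ++ [ x ])) ⟩
    (P ++ [ a ]) ++ Q ++ [ x ] ∎)
    where open ≡-Reasoning

  IsPath-prefix : ∀ {v} P {a} Q {x} → IsPath G v (P ++ a ∷ Q) x → IsPath G v P a
  IsPath-prefix {v} P {a} Q {x} path =
    AllPairs-++⁻ˡ (v ∷ P ++ [ a ]) (proj₁ path′) , Linked-++⁻ˡ (v ∷ P ++ [ a ]) (proj₂ path′)
    where path′ = subst IsSimple (prefix-path v P a Q x) path

  IsPath-∷ʳ : ∀ {v} P {a y} → IsPath G v P a → Adj a y → y ∉ v ∷ P ++ [ a ] →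
              IsPath G v (P ++ [ a ]) y
  IsPath-∷ʳ P (uniq , linked) ay y∉ =
    Unique.++⁺ uniq ([] ∷ []) (λ { (z∈ , here refl) → y∉ z∈ }) , Linked-∷ʳ P linked ay

module ShortRPaths (G : Graph) (L R : V G → Set) (partition : IsPartition G L R)
                  (u : V G) (H : Packing G) (admissible : IsAdmissiblePacking G 3 L u H) where
  open Graph G renaming (sym to Adj-sym)
  open Paths G

  ¬L⇒R : ∀ {z} → ¬ L z → R z
  ¬L⇒R {z} ¬Lz with proj₁ partition z
  ... | inj₁ Lz = ⊥-elim (¬Lz Lz)
  ... | inj₂ Rz = Rz

  L⇒¬R : ∀ {z} → L z → ¬ R z
  L⇒¬R = proj₂ partition _

  ShortRPath : V G → Set
  ShortRPath y = ∃[ w ] (InV G u H w × R w ×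
                         (IsPath G u (w ∷ []) y ⊎ ∃[ x ] (R x × IsPath G u (w ∷ x ∷ []) y)))

  L∉u∷R : ∀ {y P} → L y → y ≢ u → All R P → y ∉ u ∷ P
  L∉u∷R Ly y≢u RP = All¬⇒¬Any (y≢u ∷ All.map (λ Rz y≡z → L⇒¬R (subst L y≡z Ly) Rz) RP)

  ¬Target₁⇒¬Adj : ∀ {y} → L y → y ≢ u → ¬ Target G 1 L u y → ¬ Adj u y
  ¬Target₁⇒¬Adj Ly y≢u ¬t uy = ¬t (Ly , y≢u , [] , (((≢-sym y≢u ∷ []) ∷ [] ∷ []) , uy ∷ [-]) , s≤s z≤n , [])

  packingPathAdmissible : ∀ {P x} → (P , x) ∈ H → Admissible G 3 L u P x × Target G 3 L u x
  packingPathAdmissible = All.lookup (proj₁ admissible)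

  head∈V : ∀ {p P x} → (p ∷ P , x) ∈ H → InV G u H p
  head∈V e∈H = inj₂ (lose e∈H (here refl))

  onPackingPath : ∀ {z} → InV G u H z → z ≢ u → ∃[ P ] ∃[ x ] ((P , x) ∈ H × (z ∈ P ⊎ z ≡ x))
  onPackingPath (inj₁ z≡u) z≢u = ⊥-elim (z≢u z≡u)
  onPackingPath (inj₂ z∈H) _ with find z∈H
  ... | (P , x) , e∈H , z∈ with ∈-++⁻ P z∈
  ...   | inj₁ z∈P        = P , x , e∈H , inj₁ z∈P
  ...   | inj₂ (here z≡x) = P , x , e∈H , inj₂ z≡x

  packingPath⇒ShortRPath : ∀ {P y} → (P , y) ∈ H → Admissible G 3 L u P y → ¬ Adj u y → ShortRPath y
  packingPath⇒ShortRPath {[]}         _   ((_ , uy ∷ [-]) , _)             ¬uy = ⊥-elim (¬uy uy)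
  packingPath⇒ShortRPath {p ∷ []}     e∈H (path , _ , ¬Lp ∷ [])          _   =
    p , head∈V e∈H , ¬L⇒R ¬Lp , inj₁ path
  packingPath⇒ShortRPath {p ∷ q ∷ []} e∈H (path , _ , ¬Lp ∷ ¬Lq ∷ [])    _   =
    p , head∈V e∈H , ¬L⇒R ¬Lp , inj₂ (q , ¬L⇒R ¬Lq , path)
  packingPath⇒ShortRPath {_ ∷ _ ∷ _ ∷ _} _ (_ , s≤s (s≤s (s≤s ())) , _) _

  packingPrefix⇒ShortRPath : ∀ {P x a y} → (P , x) ∈ H → Admissible G 3 L u P x → a ∈ P →
                             Adj a y → L y → y ≢ u → ShortRPath y
  packingPrefix⇒ShortRPath {p ∷ Q} e∈H (path , _ , ¬Lp ∷ _) (here refl) ay Ly y≢u =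
    p , head∈V e∈H , ¬L⇒R ¬Lp ,
    inj₁ (IsPath-∷ʳ [] (IsPath-prefix [] Q path) ay (L∉u∷R Ly y≢u (¬L⇒R ¬Lp ∷ [])))
  packingPrefix⇒ShortRPath {p ∷ q ∷ Q} e∈H (path , _ , ¬Lp ∷ ¬Lq ∷ _) (there (here refl)) ay Ly y≢u =
    p , head∈V e∈H , ¬L⇒R ¬Lp ,
    inj₂ (q , ¬L⇒R ¬Lq , IsPath-∷ʳ [ p ] (IsPath-prefix [ p ] Q path) ay (L∉u∷R Ly y≢u (¬L⇒R ¬Lp ∷ ¬L⇒R ¬Lq ∷ [])))
  packingPrefix⇒ShortRPath {_ ∷ _ ∷ _ ∷ _} _ (_ , s≤s (s≤s (s≤s ())) , _) (there (there _)) _ _ _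

  L∩V⇒ShortRPath : ∀ {y} → InV G u H y → y ≢ u → L y → ¬ Adj u y → ShortRPath y
  L∩V⇒ShortRPath inH y≢u Ly ¬uy with onPackingPath inH y≢u
  ... | _ , _ , e∈H , inj₁ y∈P  = ⊥-elim (All.lookup (proj₂ (proj₂ (proj₁ (packingPathAdmissible e∈H)))) y∈P Ly)
  ... | _ , _ , e∈H , inj₂ refl = packingPath⇒ShortRPath e∈H (proj₁ (packingPathAdmissible e∈H)) ¬uy

  R∩V-neighbour⇒ShortRPath : ∀ {a y} → InV G u H a → a ≢ u → R a → Adj a y → L y → y ≢ u → ShortRPath y
  R∩V-neighbour⇒ShortRPath inH a≢u Ra ay Ly y≢u with onPackingPath inH a≢u
  ... | _ , _ , e∈H , inj₁ a∈P  = packingPrefix⇒ShortRPath e∈H (proj₁ (packingPathAdmissible e∈H)) a∈P ay Ly y≢u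
  ... | _ , _ , e∈H , inj₂ refl = ⊥-elim (L⇒¬R (proj₁ (proj₂ (packingPathAdmissible e∈H))) Ra)

  coveringPath⇒ShortRPath : ∀ {y Q z} → L y → y ≢ u → ¬ Adj u y →
                            Admissible G 3 L y Q u → z ∈ y ∷ Q → InV G u H z → z ≢ u → ShortRPath y
  coveringPath⇒ShortRPath Ly y≢u ¬uy _ (here refl) inH _ = L∩V⇒ShortRPath inH y≢u Ly ¬uy
  coveringPath⇒ShortRPath {Q = a ∷ []} _ _ _ (path , _ , ¬La ∷ []) (there (here refl)) inH _ =
    a , inH , ¬L⇒R ¬La , inj₁ (IsPath-reverse [ a ] path)
  coveringPath⇒ShortRPath {Q = a ∷ b ∷ []} Ly y≢u _ ((_ , ya ∷ _) , _ , ¬La ∷ _) (there (here refl)) inH a≢u =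
    R∩V-neighbour⇒ShortRPath inH a≢u (¬L⇒R ¬La) (Adj-sym ya) Ly y≢u
  coveringPath⇒ShortRPath {Q = a ∷ b ∷ []} _ _ _ (path , _ , ¬La ∷ ¬Lb ∷ []) (there (there (here refl))) inH _ =
    b , inH , ¬L⇒R ¬Lb , inj₂ (a , ¬L⇒R ¬La , IsPath-reverse (a ∷ b ∷ []) path)
  coveringPath⇒ShortRPath {Q = _ ∷ _ ∷ _ ∷ _} _ _ _ (_ , s≤s (s≤s (s≤s ())) , _) _ _ _

  covered⇒ShortRPath : ∀ {y} → L y → y ≢ u → ¬ Adj u y →
                       (Adj u y × ([] , y) ∈ H)
                       ⊎ ∃[ Q ] (Admissible G 3 L y Q u × ∃[ z ] (z ∈ y ∷ Q ++ [ u ] × InV G u H z × z ≢ u)) →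
                       ShortRPath y
  covered⇒ShortRPath _  _   ¬uy (inj₁ (uy , _)) = ⊥-elim (¬uy uy)
  covered⇒ShortRPath {y} Ly y≢u ¬uy (inj₂ (Q , path , z , z∈ , inH , z≢u)) with ∈-++⁻ (y ∷ Q) z∈
  ... | inj₁ z∈yQ       = coveringPath⇒ShortRPath Ly y≢u ¬uy path z∈yQ inH z≢u
  ... | inj₂ (here z≡u) = ⊥-elim (z≢u z≡u)

lemma7 : (G : Graph) (L R : V G → Set) → IsPartition G L R →
    (u : V G) → L u → (H : Packing G) →
    IsAdmissiblePacking G 3 L u H → Covering G L u H → Chordless G u H →
    (y : V G) → Target G 3 L u y → ¬ Target G 1 L u y →
    ∃[ w ] (InV G u H w × R w ×
    (IsPath G u (w ∷ []) y
    ⊎ ∃[ x ] (R x × IsPath G u (w ∷ x ∷ []) y)))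
lemma7 G L R partition u _ H admissible covering _ y ty@(Ly , y≢u , _) ¬ty₁ =
  covered⇒ShortRPath Ly y≢u (¬Target₁⇒¬Adj Ly y≢u ¬ty₁) (covering y ty)
  where open ShortRPaths G L R partition u H admissible
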